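{- Let $n\in L_\infty$ be composite and let $b$ be an integer with $b\equiv 2^{\varphi(n)/\operatorname{rad}(\varphi(n))}\pmod n$. Then $n$ is a Fermat pseudoprime to base $b$, i.e., $b^{n-1}\equiv 1\pmod n$.
   Context: $\varphi$ is Euler's totient function and $\operatorname{rad}(m)$ is the product of the distinct primes dividing $m$. For $k\in\mathbb{N}$, $L_k=\{n\in\mathbb{N} : \varphi(n)\mid (n-1)^k\}$ and $L_\infty=\bigcup_{k\ge1}L_k$ (equivalently, $L_\infty=\{n:\operatorname{rad}(\varphi(n))\mid n-1\}$). A composite $n$ is a Fermat pseudoprime to base $b$ if $b^{n-1}\equiv1\pmod n$. -}

module Defs where

open import Data.Nat using (ℕ; zero; suc; _*_; _∸_; _^_; _/_; _≤_; NonZero)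
open import Data.Nat.Divisibility using (_∣_; _∣?_)
open import Data.Nat.Coprimality using (Coprime; coprime?)
open import Data.Nat.Primality using (Prime; prime?)
open import Data.List using (List; length; filter; upTo; map)
open import Data.Nat.ListAction using (product)
open import Data.Product using (Σ; _×_)
open import Relation.Nullary.Decidable using (_×-dec_)
import Data.Integer as ℤ
import Data.Integer.Divisibility as ℤD

φ : ℕ → ℕ
φ n = length (filter (λ k → coprime? k n) (map suc (upTo n)))

-- rad m = product of the distinct primes dividing m (primes p ≤ m with p ∣ m).
-- (rad 0 is irrelevant here; it is the product of primes ≤ 0, i.e. 1.)
rad : ℕ → ℕ
rad m = product (filter (λ p → prime? p ×-dec (p ∣? m)) (upTo (suc m)))

L : ℕ → ℕ → Set
L k n = φ n ∣ (n ∸ 1) ^ k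

L∞ : ℕ → Set
L∞ n = Σ ℕ (λ k → (1 ≤ k) × L k n)

_≡_[mod_] : ℤ.ℤ → ℤ.ℤ → ℕ → Set
a ≡ b [mod n ] = ℤ.+ n ℤD.∣ (a ℤ.- b)

-- φ(n) / rad(φ(n)).  rad is a product of primes, hence never 0; the zero
-- clause only makes the division total and is never reached.
φ/radφ : ℕ → ℕ
φ/radφ n with rad (φ n)
... | zero  = 0
... | suc r = φ n / suc r

-- Write n = m + 1 and e = φ(n)/rad(φ(n)).  Since φ(n) ∣ m^k, every prime
-- divisor of φ(n) divides m, hence rad(φ(n)) ∣ m and φ(n) ∣ e·m.  For n ≥ 3
-- the totient is even (m ≡ -1 has square 1, so an odd φ(n) would force
-- m ≡ 1 by Euler's theorem), hence 2 ∣ m and 2 is a unit modulo n.  Euler's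
-- theorem then gives (2^e)^m = 2^(e·m) ≡ 1 (mod n), and b ≡ 2^e transports
-- this to b^m ≡ 1 (mod n).
module Submission where

open import Data.Nat
open import Data.Nat.Properties
open import Data.Nat.DivMod
open import Data.Nat.Divisibility
open import Data.Nat.Coprimality using (Coprime; coprime?; coprime-Bézout; coprime-divisor)
open import Data.Nat.GCD using (module Bézout)
open import Data.Nat.Primality
  using (Prime; Composite; composite; prime?; prime[2]; euclidsLemma; prime⇒irreducible; prime⇒nonTrivial; productOfPrimes≢0)
open import Data.Nat.ListAction using (product)
open import Data.Nat.Tactic.RingSolver using (solve-∀)
open import Data.Fin using (Fin; toℕ; fromℕ<) renaming (zero to fzero; suc to fsuc)
open import Data.Fin.Properties using (toℕ-fromℕ<; toℕ-injective; toℕ<n)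
open import Data.Fin.Permutation using (Permutation; permutation)
open import Data.List using (List; []; _∷_; [_]; _++_; length; filter; upTo; applyUpTo)
import Data.List.Properties as List
open import Data.List.Relation.Unary.All using (All; []; _∷_) renaming (map to all-map)
open import Data.List.Relation.Unary.All.Properties using (all-filter)
open import Data.List.Relation.Unary.AllPairs using ([]; _∷_)
open import Data.List.Relation.Unary.Unique.Propositional using (Unique)
open import Data.List.Relation.Unary.Unique.Propositional.Properties using (filter⁺; upTo⁺)
open import Data.Product using (∃; _×_; _,_; proj₁; proj₂)
open import Data.Sum using (inj₁; inj₂)
open import Data.Empty using (⊥-elim)
open import Relation.Nullary using (¬_; yes; no; _×-dec_)
open import Relation.Unary using (Decidable)
open import Relation.Binary.PropositionalEquality hiding ([_])
open import Data.Integer using (ℤ; +_)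
import Data.Integer as ℤ
import Data.Integer.Properties as ℤP
import Data.Integer.Divisibility.Signed as ℤS
import Data.Integer.Tactic.RingSolver as ℤRing
open import Algebra.Properties.CommutativeMonoid.Sum *-1-commutativeMonoid
  using () renaming (sum to ∏; ∑-permute to ∏-permute; ∑-distrib-+ to ∏-distrib-*)
open import Defs

∣⇒coprime-suc : ∀ {d m} → d ∣ m → Coprime d (suc m)
∣⇒coprime-suc {m = m} d∣m {i} (i∣d , i∣1+m) =
  ∣1⇒≡1 (∣m+n∣m⇒∣n (subst (i ∣_) (+-comm 1 m) i∣1+m) (∣-trans i∣d d∣m))

coprime-1 : ∀ {n} → Coprime 1 n
coprime-1 (i∣1 , _) = ∣1⇒≡1 i∣1

coprime-* : ∀ {x y n} → Coprime x n → Coprime y n → Coprime (x * y) n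
coprime-* {x} cx cy {i} (i∣xy , i∣n) = cy (coprime-divisor i⊥x i∣xy , i∣n)
  where
  i⊥x : Coprime i x
  i⊥x (j∣i , j∣x) = cx (j∣x , ∣-trans j∣i i∣n)

module Residues (n : ℕ) .{{_ : NonZero n}} where

  infix 4 _≈_

  _≈_ : ℕ → ℕ → Set
  x ≈ y = x % n ≡ y % n

  %-≈ : ∀ x → x % n ≈ x
  %-≈ x = m%n%n≡m%n x n

  *-cong : ∀ {x y z w} → x ≈ y → z ≈ w → x * z ≈ y * w
  *-cong {x} {y} {z} {w} x≈y z≈w = begin
    (x * z) % n               ≡⟨ %-distribˡ-* x z n ⟩
    ((x % n) * (z % n)) % n   ≡⟨ cong₂ (λ u v → (u * v) % n) x≈y z≈w ⟩
    ((y % n) * (w % n)) % n   ≡⟨ %-distribˡ-* y w n ⟨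
    (y * w) % n               ∎
    where open ≡-Reasoning

  ^-cong : ∀ {x y} t → x ≈ y → x ^ t ≈ y ^ t
  ^-cong zero    _   = refl
  ^-cong (suc t) x≈y = *-cong x≈y (^-cong t x≈y)

  ^-multiple-≈1 : ∀ {a t u} → a ^ t ≈ 1 → t ∣ u → a ^ u ≈ 1
  ^-multiple-≈1 {a} {t} aᵗ≈1 (divides s refl) = begin
    a ^ (s * t) % n   ≡⟨ cong (λ v → a ^ v % n) (*-comm s t) ⟩
    a ^ (t * s) % n   ≡⟨ cong (_% n) (^-*-assoc a t s) ⟨
    (a ^ t) ^ s % n   ≡⟨ ^-cong s aᵗ≈1 ⟩
    1 ^ s % n         ≡⟨ cong (_% n) (^-zeroˡ s) ⟩
    1 % n             ∎
    where open ≡-Reasoning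

  inverse : ∀ {a} → Coprime a n → ∃ λ a' → a * a' ≈ 1
  inverse {a} a⊥n with coprime-Bézout a⊥n
  ... | Bézout.+- x y 1+yn≡xa = x , (begin
    (a * x) % n       ≡⟨ cong (_% n) (*-comm a x) ⟩
    (x * a) % n       ≡⟨ cong (_% n) 1+yn≡xa ⟨
    (1 + y * n) % n   ≡⟨ [m+kn]%n≡m%n 1 y n ⟩
    1 % n             ∎)
    where open ≡-Reasoning
  ... | Bézout.-+ x y 1+xa≡yn = x * pred n , (begin
    (a * x') % n                   ≡⟨ [m+kn]%n≡m%n (a * x') y n ⟨
    (a * x' + y * n) % n           ≡⟨ cong (λ v → (a * x' + v) % n) 1+xa≡yn ⟨
    (a * x' + (1 + x * a)) % n     ≡⟨ cong (_% n) telescope ⟩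
    (1 + a * x * n) % n            ≡⟨ [m+kn]%n≡m%n 1 (a * x) n ⟩
    1 % n                          ∎)
    where
    open ≡-Reasoning
    x' : ℕ
    x' = x * pred n
    identity : ∀ a x p → a * (x * p) + (1 + x * a) ≡ 1 + a * x * suc p
    identity = solve-∀
    telescope : a * x' + (1 + x * a) ≡ 1 + a * x * n
    telescope = trans (identity a x (pred n)) (cong (λ v → 1 + a * x * v) (suc-pred n))

  *-cancel-unit : ∀ {x y c} → Coprime c n → x * c ≈ y * c → x ≈ y
  *-cancel-unit {x} {y} {c} c⊥n xc≈yc = begin
    x % n              ≡⟨ cong (_% n) (*-identityʳ x) ⟨
    (x * 1) % n        ≡⟨ *-cong {x} refl cc'≈1 ⟨
    (x * (c * c')) % n ≡⟨ cong (_% n) (*-assoc x c c') ⟨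
    (x * c * c') % n   ≡⟨ *-cong xc≈yc refl ⟩
    (y * c * c') % n   ≡⟨ cong (_% n) (*-assoc y c c') ⟩
    (y * (c * c')) % n ≡⟨ *-cong {y} refl cc'≈1 ⟩
    (y * 1) % n        ≡⟨ cong (_% n) (*-identityʳ y) ⟩
    y % n              ∎
    where
    open ≡-Reasoning
    c' : ℕ
    c' = proj₁ (inverse c⊥n)
    cc'≈1 : c * c' ≈ 1
    cc'≈1 = proj₂ (inverse c⊥n)

  residue : ℕ → Fin n
  residue x = fromℕ< (m%n<n x n)

  toℕ-residue : ∀ x → toℕ (residue x) ≡ x % n
  toℕ-residue x = toℕ-fromℕ< (m%n<n x n)

  scale : ℕ → Fin n → Fin n
  scale a k = residue (a * toℕ k)

  scale-inverse : ∀ {a a'} → a * a' ≈ 1 → ∀ k → scale a (scale a' k) ≡ k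
  scale-inverse {a} {a'} aa'≈1 k = toℕ-injective (begin
    toℕ (residue (a * toℕ (residue (a' * toℕ k))))  ≡⟨ toℕ-residue _ ⟩
    (a * toℕ (residue (a' * toℕ k))) % n           ≡⟨ cong (λ v → (a * v) % n) (toℕ-residue (a' * toℕ k)) ⟩
    (a * ((a' * toℕ k) % n)) % n                   ≡⟨ *-cong {a} refl (%-≈ (a' * toℕ k)) ⟩
    (a * (a' * toℕ k)) % n                         ≡⟨ cong (_% n) (*-assoc a a' (toℕ k)) ⟨
    (a * a' * toℕ k) % n                           ≡⟨ *-cong aa'≈1 refl ⟩
    (1 * toℕ k) % n                                ≡⟨ cong (_% n) (*-identityˡ (toℕ k)) ⟩
    toℕ k % n                                      ≡⟨ m<n⇒m%n≡m (toℕ<n k) ⟩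
    toℕ k                                          ∎)
    where open ≡-Reasoning

  scalePermutation : ∀ {a} → Coprime a n → Permutation n n
  scalePermutation {a} a⊥n =
    permutation (scale a) (scale a') (scale-inverse {a} {a'} aa'≈1) (scale-inverse {a'} {a} a'a≈1)
    where
    a' : ℕ
    a' = proj₁ (inverse a⊥n)
    aa'≈1 : a * a' ≈ 1
    aa'≈1 = proj₂ (inverse a⊥n)
    a'a≈1 : a' * a ≈ 1
    a'a≈1 = trans (cong (_% n) (*-comm a' a)) aa'≈1

  unit? : Decidable (λ x → Coprime x n)
  unit? x = coprime? x n

  ifUnit : ℕ → ℕ → ℕ
  ifUnit x v with unit? x
  ... | yes _ = v
  ... | no  _ = 1

  unitPart : ℕ → ℕ
  unitPart x = ifUnit x x

  unitPart-coprime : ∀ x → Coprime (unitPart x) n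
  unitPart-coprime x with unit? x
  ... | yes x⊥n = x⊥n
  ... | no  _   = coprime-1

  scale-coprime : ∀ {a} → Coprime a n → ∀ x → Coprime x n → Coprime ((a * x) % n) n
  scale-coprime a⊥n x x⊥n (i∣r , i∣n) = coprime-* a⊥n x⊥n (∣n∣m%n⇒∣m i∣n i∣r , i∣n)

  scale-coprime⁻¹ : ∀ a x → Coprime ((a * x) % n) n → Coprime x n
  scale-coprime⁻¹ a x r⊥n (i∣x , i∣n) = r⊥n (%-presˡ-∣ (∣n⇒∣m*n a i∣x) i∣n , i∣n)

  unitPart-scale : ∀ {a} → Coprime a n → ∀ x → unitPart ((a * x) % n) ≈ ifUnit x a * unitPart x
  unitPart-scale {a} a⊥n x with unit? x | unit? ((a * x) % n)
  ... | yes _   | yes _  = %-≈ (a * x)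
  ... | yes x⊥n | no ¬r⊥n = ⊥-elim (¬r⊥n (scale-coprime a⊥n x x⊥n))
  ... | no ¬x⊥n | yes r⊥n = ⊥-elim (¬x⊥n (scale-coprime⁻¹ a x r⊥n))
  ... | no _    | no _    = refl

  ∏-cong : ∀ {m} (f g : Fin m → ℕ) → (∀ k → f k ≈ g k) → ∏ f ≈ ∏ g
  ∏-cong {zero}  f g f≈g = refl
  ∏-cong {suc m} f g f≈g =
    *-cong (f≈g fzero) (∏-cong (λ k → f (fsuc k)) (λ k → g (fsuc k)) (λ k → f≈g (fsuc k)))

  ∏-coprime : ∀ {m} (f : Fin m → ℕ) → (∀ k → Coprime (f k) n) → Coprime (∏ f) n
  ∏-coprime {zero}  f f⊥n = coprime-1
  ∏-coprime {suc m} f f⊥n =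
    coprime-* (f⊥n fzero) (∏-coprime (λ k → f (fsuc k)) (λ k → f⊥n (fsuc k)))

  ∏-ifUnit : ∀ m (f : ℕ → ℕ) a →
             ∏ {m} (λ k → ifUnit (f (toℕ k)) a) ≡ a ^ length (filter unit? (applyUpTo f m))
  ∏-ifUnit zero    f a = refl
  ∏-ifUnit (suc m) f a with unit? (f 0)
  ... | yes f0⊥n = trans (cong (a *_) (∏-ifUnit m (λ x → f (suc x)) a))
                         (sym (cong (λ xs → a ^ length xs) (List.filter-accept unit? f0⊥n)))
  ... | no ¬f0⊥n = trans (*-identityˡ _) (trans (∏-ifUnit m (λ x → f (suc x)) a)
                         (sym (cong (λ xs → a ^ length xs) (List.filter-reject unit? ¬f0⊥n))))

  unitCount : ℕ
  unitCount = length (filter unit? (upTo n))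

  -- Euler's theorem with exponent unitCount: the product P of all units is
  -- unchanged when every residue is multiplied by a, so a^unitCount · P ≡ P.
  euler-unitCount : ∀ {a} → Coprime a n → a ^ unitCount ≈ 1
  euler-unitCount {a} a⊥n = *-cancel-unit {a ^ unitCount} {1} P⊥n (begin
    (a ^ unitCount * P) % n                ≡⟨ cong (λ v → (v * P) % n) (∏-ifUnit n (λ x → x) a) ⟨
    (∏ aᵢ * P) % n                         ≡⟨ cong (_% n) (∏-distrib-* aᵢ unitPartᵢ) ⟨
    ∏ (λ k → aᵢ k * unitPartᵢ k) % n       ≡⟨ ∏-cong _ _ scaled ⟨
    ∏ (λ k → unitPartᵢ (scale a k)) % n    ≡⟨ cong (_% n) (∏-permute unitPartᵢ π) ⟨
    P % n                                  ≡⟨ cong (_% n) (*-identityˡ P) ⟨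
    (1 * P) % n                            ∎)
    where
    open ≡-Reasoning
    aᵢ unitPartᵢ : Fin n → ℕ
    aᵢ k = ifUnit (toℕ k) a
    unitPartᵢ k = unitPart (toℕ k)
    P : ℕ
    P = ∏ unitPartᵢ
    π : Permutation n n
    π = scalePermutation a⊥n
    P⊥n : Coprime P n
    P⊥n = ∏-coprime unitPartᵢ (λ k → unitPart-coprime (toℕ k))
    scaled : ∀ k → unitPart (toℕ (scale a k)) ≈ ifUnit (toℕ k) a * unitPart (toℕ k)
    scaled k = trans (cong (λ v → unitPart v % n) (toℕ-residue (a * toℕ k)))
                     (unitPart-scale a⊥n (toℕ k))

coprime-0⇒n : ∀ {n} → Coprime 0 n → Coprime n n
coprime-0⇒n 0⊥n (i∣n , _) = 0⊥n (_ ∣0 , i∣n)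

coprime-n⇒0 : ∀ {n} → Coprime n n → Coprime 0 n
coprime-n⇒0 n⊥n (_ , i∣n) = n⊥n (i∣n , i∣n)

length-filter-[]-cong : ∀ {A : Set} {P : A → Set} (P? : Decidable P) {x y} → (P x → P y) → (P y → P x) →
                        length (filter P? [ x ]) ≡ length (filter P? [ y ])
length-filter-[]-cong P? {x} {y} x⇒y y⇒x with P? x | P? y
... | yes _   | yes _   = refl
... | no _    | no _    = refl
... | yes Px  | no ¬Py  = ⊥-elim (¬Py (x⇒y Px))
... | no ¬Px  | yes Py  = ⊥-elim (¬Px (y⇒x Py))

-- Shifting 0 … n-1 to 1 … n replaces 0 by n and keeps the number of units:
-- unitCount is φ(n).
unitCount≡φ : ∀ n .{{_ : NonZero n}} → Residues.unitCount n ≡ φ n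
unitCount≡φ n = +-cancelʳ-≡ (count [ n ]) _ _ (begin
  count (upTo n) + count [ n ]               ≡⟨ count-++ (upTo n) [ n ] ⟨
  count (upTo n ++ [ n ])                    ≡⟨ cong count (List.upTo-∷ʳ n) ⟩
  count ([ 0 ] ++ applyUpTo suc n)           ≡⟨ count-++ [ 0 ] (applyUpTo suc n) ⟩
  count [ 0 ] + count (applyUpTo suc n)      ≡⟨ cong₂ _+_ count-n≡count-0 (cong count (List.map-upTo suc n)) ⟨
  count [ n ] + φ n                          ≡⟨ +-comm (count [ n ]) (φ n) ⟩
  φ n + count [ n ]                          ∎)
  where
  open ≡-Reasoning
  Q : Decidable (λ x → Coprime x n)
  Q = Residues.unit? n
  count : List ℕ → ℕ
  count xs = length (filter Q xs)
  count-++ : ∀ xs ys → count (xs ++ ys) ≡ count xs + count ys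
  count-++ xs ys = trans (cong length (List.filter-++ Q xs ys)) (List.length-++ (filter Q xs))
  count-n≡count-0 : count [ n ] ≡ count [ 0 ]
  count-n≡count-0 = length-filter-[]-cong Q coprime-n⇒0 coprime-0⇒n

euler : ∀ n .{{_ : NonZero n}} {a} → Coprime a n → Residues._≈_ n (a ^ φ n) 1
euler n {a} a⊥n =
  subst (λ e → Residues._≈_ n (a ^ e) 1) (unitCount≡φ n) (Residues.euler-unitCount n a⊥n)

-- For n ≥ 3 the totient φ(n) is even.  With m = n - 1 ≡ -1 we have m² ≡ 1,
-- so m^(φ(n) mod 2) ≡ m^φ(n) ≡ 1 by Euler's theorem; as m ≢ 1, φ(n) mod 2 = 0.
φ-even : ∀ {n} → 3 ≤ n → 2 ∣ φ n
φ-even {n@(suc (suc (suc t)))} (s≤s (s≤s (s≤s _))) =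
  m%n≡0⇒n∣m (φ n) 2 (parity≡0 (φ n % 2) (m%n<n (φ n) 2) mʳ≈1)
  where
  open Residues n
  open ≡-Reasoning
  m r q : ℕ
  m = 2 + t
  r = φ n % 2
  q = φ n / 2
  -- (2 + t)² = 1 + (1 + t)(3 + t), with the square unfolded as the solver needs
  square : ∀ t → (2 + t) * ((2 + t) * 1) ≡ 1 + (1 + t) * (3 + t)
  square = solve-∀
  m²≈1 : m ^ 2 ≈ 1
  m²≈1 = trans (cong (_% n) (square t)) ([m+kn]%n≡m%n 1 (1 + t) n)
  m^[2q]≈1 : m ^ (q * 2) ≈ 1
  m^[2q]≈1 = ^-multiple-≈1 {m} {2} {q * 2} m²≈1 (divides q refl)
  -- φ(n) = r + 2q, so m^r ≡ m^r · m^(2q) = m^φ(n) ≡ 1.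
  mʳ≈1 : m ^ r ≈ 1
  mʳ≈1 = begin
    m ^ r % n                 ≡⟨ cong (_% n) (*-identityʳ (m ^ r)) ⟨
    (m ^ r * 1) % n           ≡⟨ *-cong {m ^ r} {m ^ r} {m ^ (q * 2)} {1} refl m^[2q]≈1 ⟨
    (m ^ r * m ^ (q * 2)) % n ≡⟨ cong (_% n) (^-distribˡ-+-* m r (q * 2)) ⟨
    m ^ (r + q * 2) % n       ≡⟨ cong (λ e → m ^ e % n) (m≡m%n+[m/n]*n (φ n) 2) ⟨
    m ^ φ n % n               ≡⟨ euler n (∣⇒coprime-suc {m} ∣-refl) ⟩
    1 % n                     ∎
  -- r ∈ {0, 1}, and r = 1 would give m ≡ 1 although 1 < m < n.
  parity≡0 : ∀ r → r < 2 → m ^ r ≈ 1 → r ≡ 0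
  parity≡0 zero          _                 _    = refl
  parity≡0 (suc zero)    _                 m≈1 with () ← begin
    m                ≡⟨ m<n⇒m%n≡m (n<1+n m) ⟨
    m % n            ≡⟨ cong (_% n) (*-identityʳ m) ⟨
    (m * 1) % n      ≡⟨ m≈1 ⟩
    1 % n            ≡⟨ m<n⇒m%n≡m {m = 1} (s≤s (s≤s (z≤n {1 + t}))) ⟩
    1                ∎
  parity≡0 (suc (suc _)) (s≤s (s≤s ())) _

prime≢1 : ∀ {p} → Prime p → p ≢ 1
prime≢1 p-prime = nonTrivial⇒≢1 {{prime⇒nonTrivial p-prime}}

prime∣^⇒prime∣ : ∀ {p N} k → Prime p → p ∣ N ^ k → p ∣ N
prime∣^⇒prime∣ zero    p-prime p∣1 = ⊥-elim (prime≢1 p-prime (∣1⇒≡1 p∣1))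
prime∣^⇒prime∣ {N = N} (suc k) p-prime p∣Nᵏ⁺¹ with euclidsLemma N (N ^ k) p-prime p∣Nᵏ⁺¹
... | inj₁ p∣N  = p∣N
... | inj₂ p∣Nᵏ = prime∣^⇒prime∣ k p-prime p∣Nᵏ

prime∤product : ∀ {p ps} → Prime p → All Prime ps → All (p ≢_) ps → ¬ p ∣ product ps
prime∤product p-prime []              []            p∣1 = prime≢1 p-prime (∣1⇒≡1 p∣1)
prime∤product {p} {q ∷ ps} p-prime (q-prime ∷ ps-prime) (p≢q ∷ p≢ps) p∣qps
  with euclidsLemma q (product ps) p-prime p∣qps
... | inj₂ p∣ps = prime∤product p-prime ps-prime p≢ps p∣ps
... | inj₁ p∣q with prime⇒irreducible q-prime p∣q
...   | inj₁ p≡1 = prime≢1 p-prime p≡1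
...   | inj₂ p≡q = p≢q p≡q

product-distinct-primes-∣ : ∀ {ps X} → Unique ps → All Prime ps → All (_∣ X) ps → product ps ∣ X
product-distinct-primes-∣ []          []              []              = 1∣ _
product-distinct-primes-∣ {p ∷ ps} {X} (p∉ps ∷ ps-unique) (p-prime ∷ ps-prime) (p∣X ∷ ps∣X)
  with product-distinct-primes-∣ ps-unique ps-prime ps∣X
... | divides q X≡q·∏ps with euclidsLemma q (product ps) p-prime (subst (p ∣_) X≡q·∏ps p∣X)
...   | inj₂ p∣∏ps            = ⊥-elim (prime∤product p-prime ps-prime p∉ps p∣∏ps)
...   | inj₁ (divides r q≡rp) = divides r (begin
        X                    ≡⟨ X≡q·∏ps ⟩
        q * product ps       ≡⟨ cong (_* product ps) q≡rp ⟩
        r * p * product ps   ≡⟨ *-assoc r p (product ps) ⟩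
        r * (p * product ps) ∎)
  where open ≡-Reasoning

primeFactor? : ∀ m → Decidable (λ p → Prime p × p ∣ m)
primeFactor? m p = prime? p ×-dec (p ∣? m)

radPrimes : ℕ → List ℕ
radPrimes m = filter (primeFactor? m) (upTo (suc m))

radPrimes-prime∣ : ∀ m → All (λ p → Prime p × p ∣ m) (radPrimes m)
radPrimes-prime∣ m = all-filter (primeFactor? m) (upTo (suc m))

rad-∣ : ∀ m {X} → (∀ {p} → Prime p → p ∣ m → p ∣ X) → rad m ∣ X
rad-∣ m primes∣X = product-distinct-primes-∣
  (filter⁺ (primeFactor? m) (upTo⁺ (suc m)))
  (all-map proj₁ (radPrimes-prime∣ m))
  (all-map (λ (p-prime , p∣m) → primes∣X p-prime p∣m) (radPrimes-prime∣ m))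

rad-∣-self : ∀ m → rad m ∣ m
rad-∣-self m = rad-∣ m (λ _ p∣m → p∣m)

rad≢0 : ∀ m → rad m ≢ 0
rad≢0 m = ≢-nonZero⁻¹ (rad m) {{productOfPrimes≢0 (all-map proj₁ (radPrimes-prime∣ m))}}

∣-/-* : ∀ {d M N} .{{_ : NonZero d}} → d ∣ M → d ∣ N → M ∣ (M / d) * N
∣-/-* {d} {M} d∣M (divides s refl) = divides s (begin
  (M / d) * (s * d)  ≡⟨ rearrange (M / d) s d ⟩
  (M / d * d) * s    ≡⟨ cong (_* s) (m/n*n≡m d∣M) ⟩
  M * s              ≡⟨ *-comm M s ⟩
  s * M              ∎)
  where
  open ≡-Reasoning
  rearrange : ∀ a b c → a * (b * c) ≡ a * c * b
  rearrange = solve-∀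

φ∣φ/radφ* : ∀ n {N} → rad (φ n) ∣ N → φ n ∣ φ/radφ n * N
φ∣φ/radφ* n rad∣N with rad (φ n) | rad≢0 (φ n) | rad-∣-self (φ n) | rad∣N
... | zero  | rad≢0 | _   | _   = ⊥-elim (rad≢0 refl)
... | suc r | _     | r∣φ | r∣N = ∣-/-* r∣φ r∣N

pos-^ : ∀ x k → + (x ^ k) ≡ (+ x) ℤ.^ k
pos-^ x zero    = refl
pos-^ x (suc k) = trans (ℤP.pos-* x (x ^ k)) (cong (λ z → + x ℤ.* z) (pos-^ x k))

mod⇒∣ : ∀ {a b n} → a ≡ b [mod n ] → (+ n) ℤS.∣ (a ℤ.- b)
mod⇒∣ {a} {b} {n} = ℤS.∣ᵤ⇒∣ {+ n} {a ℤ.- b}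

mod-trans : ∀ {a b c n} → a ≡ b [mod n ] → b ≡ c [mod n ] → a ≡ c [mod n ]
mod-trans {a} {b} {c} {n} a≡b b≡c =
  ℤS.∣⇒∣ᵤ (subst ((+ n) ℤS.∣_) (telescope a b c)
    (ℤS.∣m∣n⇒∣m+n (mod⇒∣ {a} {b} a≡b) (mod⇒∣ {b} {c} b≡c)))
  where
  telescope : ∀ a b c → (a ℤ.- b) ℤ.+ (b ℤ.- c) ≡ a ℤ.- c
  telescope = ℤRing.solve-∀

mod-^ : ∀ {a b n} k → a ≡ b [mod n ] → (a ℤ.^ k) ≡ (b ℤ.^ k) [mod n ]
mod-^ {a} {b} {n} k a≡b = ℤS.∣⇒∣ᵤ (signed k)
  where
  -- a^(k+1) - b^(k+1) = a (a^k - b^k) + (a - b) b^k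
  difference : ∀ a b x y → a ℤ.* x ℤ.- b ℤ.* y ≡ a ℤ.* (x ℤ.- y) ℤ.+ (a ℤ.- b) ℤ.* y
  difference = ℤRing.solve-∀
  signed : ∀ k → (+ n) ℤS.∣ (a ℤ.^ k ℤ.- b ℤ.^ k)
  signed zero    = ℤS.divides (+ 0) (sym (ℤP.*-zeroˡ (+ n)))
  signed (suc k) = subst ((+ n) ℤS.∣_) (sym (difference a b (a ℤ.^ k) (b ℤ.^ k)))
    (ℤS.∣m∣n⇒∣m+n (ℤS.∣n⇒∣m*n a (signed k)) (ℤS.∣m⇒∣m*n (b ℤ.^ k) (mod⇒∣ {a} {b} a≡b)))

residue-cong⇒mod : ∀ {x y} n .{{_ : NonZero n}} → x % n ≡ y % n → (+ x) ≡ (+ y) [mod n ]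
residue-cong⇒mod {x} {y} n x%n≡y%n = ℤS.∣⇒∣ᵤ (ℤS.divides (+ q ℤ.- + q') (begin
  + x ℤ.- + y                                        ≡⟨ cong₂ (λ u v → + u ℤ.- + v) x≡r+qn y≡r+q'n ⟩
  + (r + q * n) ℤ.- + (r + q' * n)                   ≡⟨ cong₂ ℤ._-_ (embed r q) (embed r q') ⟩
  (+ r ℤ.+ + q ℤ.* + n) ℤ.- (+ r ℤ.+ + q' ℤ.* + n)   ≡⟨ cancel (+ r) (+ q) (+ q') (+ n) ⟩
  (+ q ℤ.- + q') ℤ.* + n                             ∎))
  where
  open ≡-Reasoning
  r q q' : ℕ
  r  = x % n
  q  = x / n
  q' = y / n
  x≡r+qn : x ≡ r + q * n
  x≡r+qn = m≡m%n+[m/n]*n x n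
  y≡r+q'n : y ≡ r + q' * n
  y≡r+q'n = trans (m≡m%n+[m/n]*n y n) (cong (_+ q' * n) (sym x%n≡y%n))
  embed : ∀ r q → + (r + q * n) ≡ + r ℤ.+ + q ℤ.* + n
  embed r q = trans (ℤP.pos-+ r (q * n)) (cong (λ z → + r ℤ.+ z) (ℤP.pos-* q n))
  cancel : ∀ r a b m → (r ℤ.+ a ℤ.* m) ℤ.- (r ℤ.+ b ℤ.* m) ≡ (a ℤ.- b) ℤ.* m
  cancel = ℤRing.solve-∀

mainTheorem7 : (n : ℕ) → L∞ n → Composite n → (b : ℤ)
    → b ≡ (+ (2 ^ φ/radφ n)) [mod n ]
    → (b ℤ.^ (n ∸ 1)) ≡ (+ 1) [mod n ]
mainTheorem7 zero    _ (composite () _) _ _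
mainTheorem7 (suc m) (k , _ , φ∣mᵏ) (composite {d} d<n _) b b≡2ᵉ =
  mod-trans {b ℤ.^ m} {(+ (2 ^ e)) ℤ.^ m} (mod-^ m b≡2ᵉ)
    (subst (_≡ + 1 [mod n ]) (pos-^ (2 ^ e) m) (residue-cong⇒mod {(2 ^ e) ^ m} {1} n [2ᵉ]ᵐ≈1))
  where
  open Residues (suc m) using (_≈_; ^-multiple-≈1)
  n e : ℕ
  n = suc m
  e = φ/radφ n
  -- a composite number has a divisor d with 2 ≤ d < n
  3≤n : 3 ≤ n
  3≤n = ≤-trans (s≤s (nonTrivial⇒n>1 d)) d<n
  prime∣φ⇒prime∣m : ∀ {p} → Prime p → p ∣ φ n → p ∣ m
  prime∣φ⇒prime∣m p-prime p∣φ = prime∣^⇒prime∣ k p-prime (∣-trans p∣φ φ∣mᵏ)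
  2⊥n : Coprime 2 n
  2⊥n = ∣⇒coprime-suc (prime∣φ⇒prime∣m prime[2] (φ-even 3≤n))
  φ∣em : φ n ∣ e * m
  φ∣em = φ∣φ/radφ* n (rad-∣ (φ n) prime∣φ⇒prime∣m)
  [2ᵉ]ᵐ≈1 : (2 ^ e) ^ m ≈ 1
  [2ᵉ]ᵐ≈1 = subst (_≈ 1) (sym (^-*-assoc 2 e m)) (^-multiple-≈1 {2} (euler n 2⊥n) φ∣em)
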